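{- Let $(T,\lambda)$ be an edge-labeled phylogenetic tree that is least-resolved w.r.t. $\mathcal{X}=\mathcal{X}_{(T,\lambda)}$. Then there is no sequence of (extended) edge contractions $e_1e_2\dots e_\ell$ with $\ell\ge 1$ such that the resulting contracted tree $T_{e_1e_2\dots e_\ell}$ explains $\mathcal{X}$.
   Context: Phylogenetic tree: rooted, root degree $\ge2$, other inner vertices degree $\ge3$. $\lambda:E\to\{0,1\}$. $\mathcal{X}_{(T,\lambda)}$: $(x,y)$ for distinct leaves with a 1-edge on the path from $\operatorname{lca}(x,y)$ to $y$; explains means equality. Extended contraction $(T_e,\lambda_e)$ of $e=(u,v)$: contract $e$ keeping other labels; if $e$ is an outer edge, the leaf $v$ is lost, and a resulting degree-1 root $u$ is deleted (its child becoming root), or a resulting non-root degree-2 vertex $u$ with parent $w$ and child $w'$ is suppressed, the new edge $(w,w')$ being labeled $1$ iff $(w,u)$ or $(u,w')$ was. $(T,\lambda)$ is least-resolved w.r.t. $\mathcal{X}_{(T,\lambda)}$ if no single $(T_e,\lambda_e)$, $e\in E$, explains $\mathcal{X}_{(T,\lambda)}$. $T_{e_1\dots e_\ell}$ is obtained by successively contracting $e_1,\dots,e_\ell$. -}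

module Defs where

open import Data.Nat using (ℕ; suc; _≤_)
open import Data.Bool using (Bool; true; false; _∨_)
open import Data.Fin using (Fin; toℕ)
open import Data.List using (List; []; _∷_; _++_; length; lookup; take; drop; removeAt; updateAt)
open import Data.List.Relation.Unary.Unique.Propositional using (Unique)
open import Data.Product using (_×_; _,_; proj₁; proj₂)
open import Data.Sum using (_⊎_)
open import Relation.Binary.PropositionalEquality using (_≡_; _≢_)
open import Relation.Nullary using (¬_)
open import Function.Bundles using (_⇔_)

-- Rooted trees whose leaves carry names in ℕ; each child entry of an inner
-- vertex is a pair (label λ of the edge to the child , child subtree).
data Tree : Set where
  leaf : ℕ → Tree
  node : List (Bool × Tree) → Tree

lab : (cs : List (Bool × Tree)) → Fin (length cs) → Bool
lab cs i = proj₁ (lookup cs i)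

sub : (cs : List (Bool × Tree)) → Fin (length cs) → Tree
sub cs i = proj₂ (lookup cs i)

leaves : Tree → List ℕ
leavesL : List (Bool × Tree) → List ℕ
leaves (leaf x) = x ∷ []
leaves (node cs) = leavesL cs
leavesL [] = []
leavesL ((b , t) ∷ cs) = leaves t ++ leavesL cs

-- every inner vertex has at least two children (root degree ≥ 2,
-- other inner vertices degree ≥ 3)
data Shape : Tree → Set where
  leaf : ∀ {x} → Shape (leaf x)
  node : ∀ {cs} → 2 ≤ length cs → (∀ i → Shape (sub cs i)) → Shape (node cs)

Phylogenetic : Tree → Set
Phylogenetic t = Shape t × Unique (leaves t)

data LeafOf (x : ℕ) : Tree → Set where
  here  : LeafOf x (leaf x)
  there : ∀ {cs} (i : Fin (length cs)) → LeafOf x (sub cs i) → LeafOf x (node cs)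

data Below1 (y : ℕ) : Tree → Set where
  direct : ∀ {cs} (i : Fin (length cs)) → lab cs i ≡ true → LeafOf y (sub cs i)
         → Below1 y (node cs)
  deeper : ∀ {cs} (i : Fin (length cs)) → Below1 y (sub cs i) → Below1 y (node cs)

-- the relation 𝒳_(T,λ): (x , y) for distinct leaves x, y such that the path
-- from lca(x,y) to y contains an edge labelled 1
data Xrel (x y : ℕ) : Tree → Set where
  inside : ∀ {cs} (i : Fin (length cs)) → Xrel x y (sub cs i) → Xrel x y (node cs)
  across : ∀ {cs} (i j : Fin (length cs)) → i ≢ j → LeafOf x (sub cs i)
         → ((lab cs j ≡ true × LeafOf y (sub cs j)) ⊎ Below1 y (sub cs j))
         → Xrel x y (node cs)

Explains : Tree → (ℕ → ℕ → Set) → Set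
Explains t X = ∀ x y → Xrel x y t ⇔ X x y

-- edges of a tree: an edge is given by the path to its lower endpoint
data Edge : Tree → Set where
  top  : ∀ {cs} (i : Fin (length cs)) → Edge (node cs)
  down : ∀ {cs} (i : Fin (length cs)) → Edge (sub cs i) → Edge (node cs)

-- result of contracting an edge inside a subtree rooted at u:
-- either a new subtree, or u is left with a single child (b , w) and must be
-- suppressed (or deleted, if u is the root)
data Res : Set where
  keep     : Tree → Res
  collapse : Bool → Tree → Res

splice : (cs : List (Bool × Tree)) → Fin (length cs) → List (Bool × Tree) → List (Bool × Tree)
splice cs i ds = take (toℕ i) cs ++ ds ++ drop (suc (toℕ i)) cs

afterLeafRemoval : List (Bool × Tree) → Res
afterLeafRemoval ((b , w) ∷ []) = collapse b w
afterLeafRemoval cs = keep (node cs)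

-- attach a contracted subtree below an edge with label a; a collapsed vertex
-- is suppressed, the new edge getting label a ∨ b
reattach : Bool → Res → Bool × Tree
reattach a (keep t) = a , t
reattach a (collapse b w) = (a ∨ b) , w

contractAt : (t : Tree) → Edge t → Res
contractAt (node cs) (top i) with sub cs i
... | node ds = keep (node (splice cs i ds))
... | leaf _  = afterLeafRemoval (removeAt cs i)
contractAt (node cs) (down i e) =
  keep (node (updateAt cs i (λ _ → reattach (lab cs i) (contractAt (sub cs i) e))))

-- extended contraction (T_e , λ_e); a root left with one child is deleted
contract : (t : Tree) → Edge t → Tree
contract t e with contractAt t e
... | keep t' = t'
... | collapse _ w = w

data Contracts : Tree → Tree → Set where
  one  : ∀ {t} (e : Edge t) → Contracts t (contract t e)
  step : ∀ {t t'} (e : Edge t) → Contracts (contract t e) t' → Contracts t t'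

LeastResolved : Tree → Set
LeastResolved t = ∀ (e : Edge t) → ¬ Explains (contract t e) (λ x y → Xrel x y t)

module Submission where

-- Write  t' ⊑ t  when every leaf of t' is a leaf of t, every
-- leaf below a 1-edge in t' is so in t, and 𝒳_{t'} ⊆ 𝒳_t.  The key fact is
-- that a single extended contraction can only shrink 𝒳: T_e ⊑ T.  Hence for
-- a sequence e₁ … eℓ we get  T_{e₁…eℓ} ⊑ T_{e₁} ⊑ T.  If T_{e₁…eℓ} explained
-- 𝒳_T, the sandwich 𝒳_T ⊆ 𝒳_{T_{e₁}} ⊆ 𝒳_T would make the single
-- contraction T_{e₁} explain 𝒳_T, contradicting least-resolvedness.
--
-- To prove T_e ⊑ T we describe the three relations at an inner vertex
-- through its list of child entries (an "Any"/"two distinct children"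
-- description), and introduce a relation  cs' ≼ cs  on child lists: cs' arises
-- from cs by shrinking entries, removing entries, and replacing an entry by
-- the children of its subtree.  A vertex whose child list is ≼-smaller is
-- ⊑-smaller; every case of the contraction produces such a child list.

open import Defs
open import Relation.Nullary using (¬_)
open import Data.Nat using (ℕ)
open import Data.Bool using (Bool; true; false)
open import Data.Fin using (Fin; zero; suc)
open import Data.List using (List; []; _∷_; _++_; length; lookup; removeAt; updateAt)
open import Data.List.Relation.Unary.Any using (Any; here; there; index)
open import Data.List.Relation.Unary.Any.Properties using (lookup-index; ++⁻)
open import Data.Product using (Σ; _×_; _,_; proj₁; proj₂)
open import Data.Sum using (_⊎_; inj₁; inj₂; [_,_]′)
import Data.Sum as Sum
open import Relation.Binary.PropositionalEquality using (_≡_; _≢_; refl; cong)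
open import Function.Bundles using (_⇔_; mk⇔; Equivalence)
open import Data.Empty using (⊥-elim)

Entry : Set
Entry = Bool × Tree

LeafIn : ℕ → Entry → Set
LeafIn x c = LeafOf x (proj₂ c)

Via1 : ℕ → Entry → Set
Via1 y c = (proj₁ c ≡ true × LeafOf y (proj₂ c)) ⊎ Below1 y (proj₂ c)

RelIn : ℕ → ℕ → Entry → Set
RelIn x y c = Xrel x y (proj₂ c)

data Two (P Q : Entry → Set) : List Entry → Set where
  hereP : ∀ {c cs} → P c → Any Q cs → Two P Q (c ∷ cs)
  hereQ : ∀ {c cs} → Q c → Any P cs → Two P Q (c ∷ cs)
  there : ∀ {c cs} → Two P Q cs → Two P Q (c ∷ cs)

data Two++ (P Q : Entry → Set) (xs ys : List Entry) : Set where
  inLeft  : Two P Q xs → Two++ P Q xs ys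
  leftP   : Any P xs → Any Q ys → Two++ P Q xs ys
  leftQ   : Any Q xs → Any P ys → Two++ P Q xs ys
  inRight : Two P Q ys → Two++ P Q xs ys

two-++⁻ : ∀ {P Q} xs {ys} → Two P Q (xs ++ ys) → Two++ P Q xs ys
two-++⁻ []       t           = inRight t
two-++⁻ (_ ∷ xs) (hereP p a) = [ (λ b → inLeft (hereP p b)) , leftP (here p) ]′ (++⁻ xs a)
two-++⁻ (_ ∷ xs) (hereQ q a) = [ (λ b → inLeft (hereQ q b)) , leftQ (here q) ]′ (++⁻ xs a)
two-++⁻ (_ ∷ xs) (there t) with two-++⁻ xs t
... | inLeft u  = inLeft (there u)
... | leftP a b = leftP (there a) b
... | leftQ a b = leftQ (there a) b
... | inRight u = inRight u

any-at : ∀ {P : Entry → Set} (cs : List Entry) (i : Fin (length cs))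
       → P (lookup cs i) → Any P cs
any-at (_ ∷ _)  zero    p = here p
any-at (_ ∷ cs) (suc i) p = there (any-at cs i p)

two-at : ∀ {P Q : Entry → Set} (cs : List Entry) (i j : Fin (length cs)) → i ≢ j
       → P (lookup cs i) → Q (lookup cs j) → Two P Q cs
two-at (_ ∷ _)  zero    zero    i≢j p q = ⊥-elim (i≢j refl)
two-at (_ ∷ cs) zero    (suc j) i≢j p q = hereP p (any-at cs j q)
two-at (_ ∷ cs) (suc i) zero    i≢j p q = hereQ q (any-at cs i p)
two-at (_ ∷ cs) (suc i) (suc j) i≢j p q = 
  there (two-at cs i j (λ i≡j → i≢j (cong suc i≡j)) p q)

record TwoAt (P Q : Entry → Set) (cs : List Entry) : Set where
  constructor twoAt
  field
    i j   : Fin (length cs)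
    i≢j   : i ≢ j
    atI   : P (lookup cs i)
    atJ   : Q (lookup cs j)

two-positions : ∀ {P Q cs} → Two P Q cs → TwoAt P Q cs
two-positions (hereP p a) = twoAt zero (suc (index a)) (λ ()) p (lookup-index a)
two-positions (hereQ q a) = twoAt (suc (index a)) zero (λ ()) (lookup-index a) q
two-positions (there t) with two-positions t
... | twoAt i j i≢j p q = twoAt (suc i) (suc j) (λ { refl → i≢j refl }) p q

leafOf-node : ∀ {x cs} → LeafOf x (node cs) ⇔ Any (LeafIn x) cs
leafOf-node {cs = cs} = mk⇔ (λ { (there i l) → any-at cs i l })
                            (λ a → there (index a) (lookup-index a))

below1-node : ∀ {y cs} → Below1 y (node cs) ⇔ Any (Via1 y) cs
below1-node {cs = cs} = mk⇔ to from
  where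
  to : ∀ {y} → Below1 y (node cs) → Any (Via1 y) cs
  to (direct i e l) = any-at cs i (inj₁ (e , l))
  to (deeper i b)   = any-at cs i (inj₂ b)
  from : ∀ {y} → Any (Via1 y) cs → Below1 y (node cs)
  from a with lookup-index a
  ... | inj₁ (e , l) = direct (index a) e l
  ... | inj₂ b       = deeper (index a) b

XrelN : ℕ → ℕ → List Entry → Set
XrelN x y cs = Any (RelIn x y) cs ⊎ Two (LeafIn x) (Via1 y) cs

xrel-node : ∀ {x y cs} → Xrel x y (node cs) ⇔ XrelN x y cs
xrel-node {cs = cs} = mk⇔ to from
  where
  to : ∀ {x y} → Xrel x y (node cs) → XrelN x y cs
  to (inside i r)         = inj₁ (any-at cs i r)
  to (across i j i≢j l q) = inj₂ (two-at cs i j i≢j l q)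
  from : ∀ {x y} → XrelN x y cs → Xrel x y (node cs)
  from (inj₁ a) = inside (index a) (lookup-index a)
  from (inj₂ t) with two-positions t
  ... | twoAt i j i≢j l q = across i j i≢j l q

open Equivalence using (to; from)

record _⊑_ (t' t : Tree) : Set where
  field
    leaf≤  : ∀ {x} → LeafOf x t' → LeafOf x t
    below≤ : ∀ {y} → Below1 y t' → Below1 y t
    xrel≤  : ∀ {x y} → Xrel x y t' → Xrel x y t
open _⊑_

⊑-refl : ∀ {t} → t ⊑ t
⊑-refl = record { leaf≤ = λ l → l ; below≤ = λ b → b ; xrel≤ = λ r → r }

⊑-trans : ∀ {t₁ t₂ t₃} → t₁ ⊑ t₂ → t₂ ⊑ t₃ → t₁ ⊑ t₃
⊑-trans p q = record
  { leaf≤ = λ l → leaf≤ q (leaf≤ p l)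
  ; below≤ = λ b → below≤ q (below≤ p b)
  ; xrel≤ = λ r → xrel≤ q (xrel≤ p r) }

child-⊑ : ∀ cs (i : Fin (length cs)) → sub cs i ⊑ node cs
child-⊑ cs i = record { leaf≤ = there i ; below≤ = deeper i ; xrel≤ = inside i }

record _⊑ₑ_ (c' c : Entry) : Set where
  field
    tree≤ : proj₂ c' ⊑ proj₂ c
    via≤  : ∀ {y} → Via1 y c' → Via1 y c
open _⊑ₑ_

⊑ₑ-refl : ∀ {c} → c ⊑ₑ c
⊑ₑ-refl = record { tree≤ = ⊑-refl ; via≤ = λ v → v }

data _≼_ : List Entry → List Entry → Set where
  []      : [] ≼ []
  keep    : ∀ {c' c cs' cs} → c' ⊑ₑ c → cs' ≼ cs → (c' ∷ cs') ≼ (c ∷ cs)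
  skip    : ∀ {cs' cs} c → cs' ≼ cs → cs' ≼ (c ∷ cs)
  flatten : ∀ {cs' cs} a ds → cs' ≼ cs → (ds ++ cs') ≼ ((a , node ds) ∷ cs)

≼-refl : ∀ {cs} → cs ≼ cs
≼-refl {[]}     = []
≼-refl {_ ∷ _}  = keep ⊑ₑ-refl ≼-refl

any-≼ : ∀ {P : Entry → Set} {cs' cs}
      → (∀ {c' c} → c' ⊑ₑ c → P c' → P c)
      → (∀ {a ds} → Any P ds → P (a , node ds))
      → cs' ≼ cs → Any P cs' → Any P cs
any-≼ mono absorb (keep c'⊑c _) (here p)  = here (mono c'⊑c p)
any-≼ mono absorb (keep _ m)    (there a) = there (any-≼ mono absorb m a)
any-≼ mono absorb (skip _ m)    a         = there (any-≼ mono absorb m a)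
any-≼ mono absorb (flatten _ ds m) a      =
  [ (λ b → here (absorb b)) , (λ b → there (any-≼ mono absorb m b)) ]′ (++⁻ ds a)

leafIn-≼ : ∀ {x cs' cs} → cs' ≼ cs → Any (LeafIn x) cs' → Any (LeafIn x) cs
leafIn-≼ = any-≼ (λ c'⊑c → leaf≤ (tree≤ c'⊑c)) (from leafOf-node)

via1-≼ : ∀ {y cs' cs} → cs' ≼ cs → Any (Via1 y) cs' → Any (Via1 y) cs
via1-≼ = any-≼ (λ c'⊑c → via≤ c'⊑c) (λ a → inj₂ (from below1-node a))

relIn-≼ : ∀ {x y cs' cs} → cs' ≼ cs → Any (RelIn x y) cs' → Any (RelIn x y) cs
relIn-≼ = any-≼ (λ c'⊑c → xrel≤ (tree≤ c'⊑c)) (λ a → from xrel-node (inj₁ a))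

-- A pair across two children of cs' is across two children of cs, or both
-- children were flattened into one child of cs, which then relates x and y.
two-≼ : ∀ {x y cs' cs} → cs' ≼ cs → Two (LeafIn x) (Via1 y) cs' → XrelN x y cs
two-≼ (keep c'⊑c m) (hereP l a) = inj₂ (hereP (leaf≤ (tree≤ c'⊑c) l) (via1-≼ m a))
two-≼ (keep c'⊑c m) (hereQ v a) = inj₂ (hereQ (via≤ c'⊑c v) (leafIn-≼ m a))
two-≼ (keep _ m)    (there t)   = Sum.map there there (two-≼ m t)
two-≼ (skip _ m)    t           = Sum.map there there (two-≼ m t)
two-≼ (flatten _ ds m) t with two-++⁻ ds t
... | inLeft u  = inj₁ (here (from xrel-node (inj₂ u)))
... | leftP a b = inj₂ (hereP (from leafOf-node a) (via1-≼ m b))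
... | leftQ a b = inj₂ (hereQ (inj₂ (from below1-node a)) (leafIn-≼ m b))
... | inRight u = Sum.map there there (two-≼ m u)

node-⊑ : ∀ {cs' cs} → cs' ≼ cs → node cs' ⊑ node cs
node-⊑ m = record
  { leaf≤  = λ l → from leafOf-node (leafIn-≼ m (to leafOf-node l))
  ; below≤ = λ b → from below1-node (via1-≼ m (to below1-node b))
  ; xrel≤  = λ r → from xrel-node
                     ([ (λ a → inj₁ (relIn-≼ m a)) , two-≼ m ]′ (to xrel-node r)) }

splice-≼ : ∀ cs (i : Fin (length cs)) ds → sub cs i ≡ node ds → splice cs i ds ≼ cs
splice-≼ ((a , _) ∷ cs) zero    ds refl = flatten a ds ≼-refl
splice-≼ (_ ∷ cs)       (suc i) ds eq   = keep ⊑ₑ-refl (splice-≼ cs i ds eq)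

removeAt-≼ : ∀ cs (i : Fin (length cs)) → removeAt cs i ≼ cs
removeAt-≼ (c ∷ cs) zero    = skip c ≼-refl
removeAt-≼ (_ ∷ cs) (suc i) = keep ⊑ₑ-refl (removeAt-≼ cs i)

updateAt-≼ : ∀ cs (i : Fin (length cs)) {c'} → c' ⊑ₑ lookup cs i
           → updateAt cs i (λ _ → c') ≼ cs
updateAt-≼ (_ ∷ _)  zero    c'⊑c = keep c'⊑c ≼-refl
updateAt-≼ (_ ∷ cs) (suc i) c'⊑c = keep ⊑ₑ-refl (updateAt-≼ cs i c'⊑c)

-- A contraction result is dominated by the subtree it came from; a collapsed
-- vertex u with single child w also records that a 1-edge (u, w) lies on
-- paths of the original subtree.
Shrinks : Res → Tree → Set
Shrinks (keep t')      t = t' ⊑ t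
Shrinks (collapse b w) t = w ⊑ t × (b ≡ true → ∀ {y} → LeafOf y w → Below1 y t)

afterLeafRemoval-shrinks : ∀ {rs cs} → rs ≼ cs → Shrinks (afterLeafRemoval rs) (node cs)
afterLeafRemoval-shrinks {[]}           m = node-⊑ m
afterLeafRemoval-shrinks {(b , w) ∷ []} m =
  ⊑-trans (child-⊑ ((b , w) ∷ []) zero) (node-⊑ m)
  , λ e l → below≤ (node-⊑ m) (direct zero e l)
afterLeafRemoval-shrinks {_ ∷ _ ∷ _}    m = node-⊑ m

-- Suppressing a collapsed vertex below an a-edge: the merged label a ∨ b
-- keeps exactly the 1-edges of the path a, b.
reattach-⊑ₑ : ∀ a r t → Shrinks r t → reattach a r ⊑ₑ (a , t)
reattach-⊑ₑ a     (keep t')      t t'⊑t = record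
  { tree≤ = t'⊑t
  ; via≤  = λ { (inj₁ (e , l)) → inj₁ (e , leaf≤ t'⊑t l)
              ; (inj₂ b)       → inj₂ (below≤ t'⊑t b) } }
reattach-⊑ₑ true  (collapse b w) t (w⊑t , _) = record
  { tree≤ = w⊑t
  ; via≤  = λ { (inj₁ (_ , l)) → inj₁ (refl , leaf≤ w⊑t l)
              ; (inj₂ b)       → inj₂ (below≤ w⊑t b) } }
reattach-⊑ₑ false (collapse b w) t (w⊑t , one-edge) = record
  { tree≤ = w⊑t
  ; via≤  = λ { (inj₁ (e , l)) → inj₂ (one-edge e l)
              ; (inj₂ b)       → inj₂ (below≤ w⊑t b) } }

contractAt-shrinks : ∀ t (e : Edge t) → Shrinks (contractAt t e) t
contractAt-shrinks (node cs) (top i) with sub cs i in eq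
... | node ds = node-⊑ (splice-≼ cs i ds eq)
... | leaf _  = afterLeafRemoval-shrinks (removeAt-≼ cs i)
contractAt-shrinks (node cs) (down i e) =
  node-⊑ (updateAt-≼ cs i (reattach-⊑ₑ (lab cs i) (contractAt (sub cs i) e) (sub cs i)
                                       (contractAt-shrinks (sub cs i) e)))

contract-⊑ : ∀ t (e : Edge t) → contract t e ⊑ t
contract-⊑ t e with contractAt t e | contractAt-shrinks t e
... | keep _       | t'⊑t      = t'⊑t
... | collapse _ _ | (w⊑t , _) = w⊑t

contracts-⊑ : ∀ {t t'} → Contracts t t' → t' ⊑ t
contracts-⊑ {t} (one e)    = contract-⊑ t e
contracts-⊑ {t} (step e c) = ⊑-trans (contracts-⊑ c) (contract-⊑ t e)

first-contraction : ∀ {t t'} → Contracts t t' → Σ (Edge t) λ e → t' ⊑ contract t e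
first-contraction (one e)    = e , ⊑-refl
first-contraction (step e c) = e , contracts-⊑ c

lemma10 : ∀ (T : Tree) → Phylogenetic T → LeastResolved T
        → ∀ (T' : Tree) → Contracts T T' → ¬ Explains T' (λ x y → Xrel x y T)
lemma10 T _ least-resolved T' c T'-explains with first-contraction c
... | e , T'⊑Tₑ =
  -- 𝒳_T = 𝒳_{T'} ⊆ 𝒳_{T_e} ⊆ 𝒳_T, so the single contraction T_e explains 𝒳_T
  least-resolved e λ x y →
    mk⇔ (xrel≤ (contract-⊑ T e)) (λ r → xrel≤ T'⊑Tₑ (from (T'-explains x y) r))
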